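{- Let $\mathbb{F}$ be a field of characteristic $0$, $n\in\mathbb{N}$, $\varkappa\in\mathbb{N}^n$ (all $\varkappa_j\ge1$), $N=|\varkappa|$ and $m\in\mathbb{N}_0$. Then the following identity holds in $\mathbb{F}(y_1,\ldots,y_n)$: \[ \operatorname{h}_m(y^{[\varkappa]})=\frac{\det G_{(m),\varkappa}(y)}{\det V_\varkappa(y)}. \]
   Context: $\operatorname{h}_m(x_1,\ldots,x_N)=\sum_{k\in\mathbb{N}_0^N,\ |k|=m}x_1^{k_1}\cdots x_N^{k_N}$; $y^{[\varkappa]}$ is the list consisting of $y_1$ repeated $\varkappa_1$ times, then $y_2$ repeated $\varkappa_2$ times, ..., then $y_n$ repeated $\varkappa_n$ times. Let $\sigma(\varkappa)_q=\varkappa_1+\cdots+\varkappa_q$, $\sigma(\varkappa)_0=0$; every $k\in\{1,\ldots,N\}$ is written uniquely as $k=\sigma(\varkappa)_{q-1}+r$ with $q\in\{1,\ldots,n\}$, $r\in\{1,\ldots,\varkappa_q\}$. $G_{(m),\varkappa}(y)$ is the $N\times N$ matrix whose $(j,k)$ entry (with $k=\sigma(\varkappa)_{q-1}+r$) is: for $1\le j\le N-1$, $\binom{j-1}{r-1}y_q^{j-r}$ if $j\ge r$ and $0$ otherwise; for $j=N$, $\binom{N-1+m}{r-1}y_q^{m+N-r}$. The confluent Vandermonde matrix is $V_\varkappa(y)=G_{(0),\varkappa}(y)$. -}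

module Defs where

open import Level using (Level; _⊔_)
open import Algebra.Bundles using (CommutativeRing)
open import Data.Nat as ℕ using (ℕ; zero; suc; _∸_; _≤ᵇ_)
open import Data.Nat.Combinatorics using (_C_)
open import Data.Bool using (if_then_else_)
open import Data.Fin as Fin using (Fin; zero; suc; toℕ; splitAt; punchIn)
open import Data.Vec as Vec using (Vec; []; _∷_; lookup)
open import Data.List as List using (List; []; _∷_; _++_)
open import Data.Product using (_×_; _,_; ∃)
open import Data.Sum using (inj₁; inj₂)
open import Relation.Nullary using (¬_)

record Field (c ℓ : Level) : Set (Level.suc (c ⊔ ℓ)) where
  field
    commutativeRing : CommutativeRing c ℓ
  open CommutativeRing commutativeRing public
  field
    1≉0     : ¬ (1# ≈ 0#)
    inverse : ∀ x → ¬ (x ≈ 0#) → ∃ λ y → (x * y) ≈ 1#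

module FieldOps {c ℓ} (F : Field c ℓ) where
  open Field F using (Carrier; _≈_; _+_; _*_; -_; 0#; 1#)

  ι : ℕ → Carrier
  ι zero    = 0#
  ι (suc n) = 1# + ι n

  _^_ : Carrier → ℕ → Carrier
  x ^ zero  = 1#
  x ^ suc n = x * (x ^ n)

  CharZero : Set ℓ
  CharZero = ∀ n → ¬ (ι (suc n) ≈ 0#)

  Σ : ∀ {n} → (Fin n → Carrier) → Carrier
  Σ {zero}  f = 0#
  Σ {suc n} f = f zero + Σ (λ i → f (suc i))

  sumL : List Carrier → Carrier
  sumL = List.foldr _+_ 0#

  prodL : List Carrier → Carrier
  prodL = List.foldr _*_ 1#

  det : ∀ {N} → (Fin N → Fin N → Carrier) → Carrier
  det {zero}  M = 1#
  det {suc N} M = Σ λ k → sgn (toℕ k) (M zero k * det (λ i j → M (suc i) (punchIn k j)))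
    where
    sgn : ℕ → Carrier → Carrier
    sgn zero          x = x
    sgn (suc zero)    x = - x
    sgn (suc (suc k)) x = sgn k x

  boxVecs : ℕ → (N : ℕ) → List (Vec ℕ N)
  boxVecs m zero    = [] ∷ []
  boxVecs m (suc N) =
    List.concatMap (λ a → List.map (a ∷_) (boxVecs m N)) (List.upTo (suc m))

  multiIndices : ℕ → (N : ℕ) → List (Vec ℕ N)
  multiIndices m N =
    List.filter (λ k → Data.Nat._≟_ (Vec.sum k) m) (boxVecs m N)
    where import Data.Nat

  monomial : ∀ {N} → Vec Carrier N → Vec ℕ N → Carrier
  monomial []       []       = 1#
  monomial (x ∷ xs) (k ∷ ks) = (x ^ k) * monomial xs ks

  h : ℕ → ∀ {N} → Vec Carrier N → Carrier
  h m {N} x = sumL (List.map (monomial x) (multiIndices m N))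

  rep : ∀ {n} (κ : Vec ℕ n) → Vec Carrier n → Vec Carrier (Vec.sum κ)
  rep []      []      = []
  rep (c ∷ κ) (y ∷ ys) = Vec.replicate c y Vec.++ rep κ ys

  -- column index k (0-based, in Fin N) ↦ (q, r) with k+1 = σ(κ)_{q-1} + r,
  -- q returned as Fin n (0-based), r as a 1-based natural number.
  locate : ∀ {n} (κ : Vec ℕ n) → Fin (Vec.sum κ) → Fin n × ℕ
  locate (c ∷ κ) k with splitAt c k
  ... | inj₁ i = zero , suc (toℕ i)
  ... | inj₂ i with locate κ i
  ...   | q , r = suc q , r

  -- G_{(m),κ}(y); rows j and r are 1-based in the formulas
  G : ℕ → ∀ {n} (κ : Vec ℕ n) → Vec Carrier n →
      Fin (Vec.sum κ) → Fin (Vec.sum κ) → Carrier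
  G m {n} κ y j' k with locate κ k
  ... | q , r =
    if suc (toℕ j') ≤ᵇ (N ∸ 1)
      then (if r ≤ᵇ j then ι ((j ∸ 1) C (r ∸ 1)) * (lookup y q ^ (j ∸ r)) else 0#)
      else ι (((N ∸ 1) ℕ.+ m) C (r ∸ 1)) * (lookup y q ^ ((m ℕ.+ N) ∸ r))
    where
    N = Vec.sum κ
    j = suc (toℕ j')

  V : ∀ {n} (κ : Vec ℕ n) → Vec Carrier n → Fin (Vec.sum κ) → Fin (Vec.sum κ) → Carrier
  V = G 0

module Submission where

open import Defs
open import Data.Nat using (ℕ; _≤_)
open import Data.Vec using (Vec)
open import Data.Vec.Relation.Unary.All using (All)
open import Relation.Nullary using (¬_)

-- Read column k of G and V, with node y_q and r = s + 1, as the functional p ↦ p⁽ˢ⁾(y_q)/s!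
-- applied to the polynomial x^(j-1) of row j (x^(N-1+m) in the last row of G). Putting an
-- arbitrary polynomial p into the last row gives a linear functional Λ(p). It kills x^i for
-- i < N - 1 (two equal rows) and every multiple of P = ∏ (x - x_i) over x = y^[κ], since y_q is a
-- root of P of multiplicity κ_q. Peeling off one root p at a time, with x·x^j = (x - p)·x^j + p·x^j
-- and h_{m+1}(p, x′) = h_{m+1}(x′) + p·h_m(p, x′), gives Λ(x^(N-1+m)) = h_m(x)·Λ(x^(N-1)),
-- i.e. det G = h_m(y^[κ])·det V.
-- Determinants enter only through Laplace expansion along the first row: Λ is linear in the last
-- row, and two equal rows give determinant 0 because the expansion along the first two rows is
-- alternating in them.

open import Level using (_⊔_)
open import Function using (_∘_)
open import Data.Bool using (T; true; false; if_then_else_)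
open import Data.Empty using (⊥-elim)
open import Data.Product using (_,_; proj₁; proj₂; ∃)
open import Data.Sum using (inj₁; inj₂)
open import Data.Nat as ℕ using (zero; suc; _∸_; _<_; _≤ᵇ_; z≤n; s≤s)
import Data.Nat.Properties as ℕₚ
open import Data.Nat.Combinatorics using (_C_; nCk+nC[k+1]≡[n+1]C[k+1]; k>n⇒nCk≡0)
open import Data.Fin as Fin using (Fin; zero; suc; toℕ; punchIn; splitAt)
import Data.Fin.Properties as Finₚ
open import Data.Vec as Vec using ([]; _∷_; lookup)
open import Data.Vec.Relation.Unary.All using (_∷_)
open import Data.List as List using (List)
import Data.List.Properties as Listₚ
import Data.List.Relation.Unary.All as ListAll
open import Relation.Binary.PropositionalEquality as ≡ using (_≡_)
open import Relation.Nullary using (yes; no; does)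
open import Relation.Unary using (Pred; Decidable)

module ConfluentVandermonde {c ℓ} (F : Field c ℓ) where
  open Field F hiding (zero)
  open FieldOps F
  open import Algebra.Properties.Ring ring
    using (-‿distribˡ-*; -‿distribʳ-*; -‿involutive; -‿anti-homo-+; -‿+-comm; -0#≈0#)
  open import Algebra.Solver.Ring.NaturalCoefficients.Default commutativeSemiring
    using (solve; _:=_; _:+_; _:*_; con)
  open import Relation.Binary.Reasoning.Setoid setoid

  -- Determinants by Laplace expansion

  Σ-cong : ∀ {n} {f g : Fin n → Carrier} → (∀ k → f k ≈ g k) → Σ f ≈ Σ g
  Σ-cong {zero}  f≈g = refl
  Σ-cong {suc n} f≈g = +-cong (f≈g zero) (Σ-cong (f≈g ∘ suc))

  Σ-zero : ∀ {n} {f : Fin n → Carrier} → (∀ k → f k ≈ 0#) → Σ f ≈ 0#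
  Σ-zero {zero}  f≈0 = refl
  Σ-zero {suc n} f≈0 = trans (+-cong (f≈0 zero) (Σ-zero (f≈0 ∘ suc))) (+-identityʳ 0#)

  Σ-+ : ∀ {n} (f g : Fin n → Carrier) → Σ (λ k → f k + g k) ≈ Σ f + Σ g
  Σ-+ {zero}  f g = sym (+-identityʳ 0#)
  Σ-+ {suc n} f g = trans (+-congˡ (Σ-+ (f ∘ suc) (g ∘ suc)))
    (solve 4 (λ a b u v → (a :+ b) :+ (u :+ v) := (a :+ u) :+ (b :+ v)) refl (f zero) (g zero) _ _)

  Σ-*ˡ : ∀ {n} a (f : Fin n → Carrier) → Σ (λ k → a * f k) ≈ a * Σ f
  Σ-*ˡ {zero}  a f = sym (zeroʳ a)
  Σ-*ˡ {suc n} a f = trans (+-congˡ (Σ-*ˡ a (f ∘ suc))) (sym (distribˡ a _ _))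

  Σ-neg : ∀ {n} (f : Fin n → Carrier) → Σ (λ k → - f k) ≈ - Σ f
  Σ-neg {zero}  f = sym -0#≈0#
  Σ-neg {suc n} f = trans (+-congˡ (Σ-neg (f ∘ suc))) (-‿+-comm _ _)

  x≈0⇒s*[a*x]≈0 : ∀ s a {x} → x ≈ 0# → s * (a * x) ≈ 0#
  x≈0⇒s*[a*x]≈0 s a x≈0 = trans (*-congˡ (trans (*-congˡ x≈0) (zeroʳ a))) (zeroʳ s)

  Mat : ℕ → Set c
  Mat n = Fin n → Fin n → Carrier

  minor : ∀ {n} → Fin (suc n) → Mat (suc n) → Mat n
  minor k M i j = M (suc i) (punchIn k j)

  sign : ℕ → Carrier
  sign zero    = 1#
  sign (suc n) = - sign n

  expand₁ : ∀ {n} → (Fin (suc n) → Carrier) → ((Fin n → Fin (suc n)) → Carrier) → Carrier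
  expand₁ a Ψ = Σ (λ k → sign (toℕ k) * (a k * Ψ (punchIn k)))

  detBelow : ∀ {m n} → (Fin (suc m) → Fin n → Carrier) → (Fin m → Fin n) → Carrier
  detBelow M σ = det (λ i j → M (suc i) (σ j))

  -- Defs.det signs its terms by a where-bound function, which cannot be named. The metavariables
  -- in the types of laplace-term and laplace-sign are solved to it by the use in det-expand, and
  -- with-abstraction turns its arguments into variables so that its defining equations apply.
  mutual
    det-expand : ∀ {n} (M : Mat (suc n)) → det M ≈ expand₁ (M zero) (detBelow M)
    det-expand M = +-cong (sym (*-identityˡ _)) (Σ-cong (laplace-term M))

    laplace-term : ∀ {n} (M : Mat (suc n)) (k : Fin n) →
                   _ ≈ sign (suc (toℕ k)) * (M zero (suc k) * det (minor (suc k) M))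
    laplace-term M k with toℕ k | M zero (suc k) * det (minor (suc k) M)
    ... | i | x = laplace-sign M i x

    laplace-sign : ∀ {n} (M : Mat (suc n)) i x → _ ≈ sign (suc i) * x
    laplace-sign M zero          x = trans (-‿cong (sym (*-identityˡ x))) (-‿distribˡ-* 1# x)
    laplace-sign M (suc zero)    x = trans (sym (*-identityˡ x)) (*-congʳ (sym (-‿involutive 1#)))
    laplace-sign M (suc (suc i)) x =
      trans (laplace-sign M i x) (*-congʳ (sym (-‿involutive (sign (suc i)))))

  det-cong : ∀ {n} {M M′ : Mat n} → (∀ i j → M i j ≈ M′ i j) → det M ≈ det M′
  det-cong {zero}  _ = refl
  det-cong {suc n} {M} {M′} M≈M′ = begin
    det M                               ≈⟨ det-expand M ⟩
    expand₁ (M zero) (detBelow M)       ≈⟨ Σ-cong (λ k → *-congˡ {sign (toℕ k)} (*-cong (M≈M′ zero k)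
                                             (det-cong (λ i j → M≈M′ (suc i) (punchIn k j))))) ⟩
    expand₁ (M′ zero) (detBelow M′)     ≈⟨ det-expand M′ ⟨
    det M′                              ∎

  -- The test is the one in Defs.G, so that G is pointwise of this form, and a minor of
  -- withLastRow A w is definitionally withLastRow of the minor of A.
  withLastRow : ∀ {n} → Mat n → (Fin n → Carrier) → Mat n
  withLastRow {n} A w i j = if suc (toℕ i) ≤ᵇ n ∸ 1 then A i j else w j

  withLastRow-cong : ∀ {n} (A : Mat n) {w w′ : Fin n → Carrier} → (∀ j → w j ≈ w′ j) →
                     ∀ i j → withLastRow A w i j ≈ withLastRow A w′ i j
  withLastRow-cong {n} A w≈w′ i j with suc (toℕ i) ≤ᵇ n ∸ 1
  ... | true  = refl
  ... | false = w≈w′ j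

  withLastRow-above : ∀ {n} (A : Mat n) w {i} → suc (toℕ i) ≤ n ∸ 1 → ∀ j → withLastRow A w i j ≡ A i j
  withLastRow-above {n} A w {i} i<last j with suc (toℕ i) ≤ᵇ n ∸ 1 | ℕₚ.≤⇒≤ᵇ i<last
  ... | true | _ = ≡.refl

  withLastRow-last : ∀ {n} (A : Mat n) w {i} → toℕ i ≡ n ∸ 1 → ∀ j → withLastRow A w i j ≡ w j
  withLastRow-last {n} A w {i} i≡last j with suc (toℕ i) ≤ᵇ n ∸ 1 in test
  ... | false = ≡.refl
  ... | true  = ⊥-elim (ℕₚ.<-irrefl i≡last (ℕₚ.≤ᵇ⇒≤ (suc (toℕ i)) (n ∸ 1) (≡.subst T (≡.sym test) _)))

  det-withLastRow-linear : ∀ {n} (A : Mat (suc n)) (u v : Fin (suc n) → Carrier) β →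
    det (withLastRow A (λ j → u j + β * v j)) ≈ det (withLastRow A u) + β * det (withLastRow A v)
  det-withLastRow-linear {zero} A u v β =
    solve 3 (λ u v β → (u :+ β :* v) :* con 1 :+ con 0 := (u :* con 1 :+ con 0) :+ β :* (v :* con 1 :+ con 0))
            refl (u zero) (v zero) β
  det-withLastRow-linear {suc n} A u v β = begin
    det (withLastRow A w)
      ≈⟨ det-expand (withLastRow A w) ⟩
    Σ (λ k → sign (toℕ k) * (A zero k * det (minorWith k w)))
      ≈⟨ Σ-cong (λ k → *-congˡ {sign (toℕ k)} (*-congˡ {A zero k}
           (det-withLastRow-linear (minor k A) (u ∘ punchIn k) (v ∘ punchIn k) β))) ⟩
    Σ (λ k → sign (toℕ k) * (A zero k * (det (minorWith k u) + β * det (minorWith k v))))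
      ≈⟨ Σ-cong (λ k → solve 5 (λ s a x β y → s :* (a :* (x :+ β :* y))
                                             := s :* (a :* x) :+ β :* (s :* (a :* y)))
                               refl (sign (toℕ k)) (A zero k) (det (minorWith k u)) β (det (minorWith k v))) ⟩
    Σ (λ k → term u k + β * term v k)
      ≈⟨ trans (Σ-+ (term u) (λ k → β * term v k)) (+-congˡ (Σ-*ˡ β (term v))) ⟩
    Σ (term u) + β * Σ (term v)
      ≈⟨ +-cong (det-expand (withLastRow A u)) (*-congˡ (det-expand (withLastRow A v))) ⟨
    det (withLastRow A u) + β * det (withLastRow A v) ∎
    where
    w = λ j → u j + β * v j
    minorWith : Fin (suc (suc n)) → (Fin (suc (suc n)) → Carrier) → Mat (suc n)
    minorWith k r = withLastRow (minor k A) (r ∘ punchIn k)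
    term : (Fin (suc (suc n)) → Carrier) → Fin (suc (suc n)) → Carrier
    term r k = sign (toℕ k) * (A zero k * det (minorWith k r))

  det-withLastRow-zero : ∀ {n} (A : Mat (suc n)) {w} → (∀ j → w j ≈ 0#) → det (withLastRow A w) ≈ 0#
  det-withLastRow-zero {zero}  A w≈0 = trans (+-identityʳ _) (trans (*-congʳ (w≈0 zero)) (zeroˡ 1#))
  det-withLastRow-zero {suc n} A {w} w≈0 = trans (det-expand (withLastRow A w))
    (Σ-zero (λ k → x≈0⇒s*[a*x]≈0 (sign (toℕ k)) (A zero k)
                     (det-withLastRow-zero (minor k A) (w≈0 ∘ punchIn k))))

  Extensional : ∀ {m n} → ((Fin m → Fin n) → Carrier) → Set ℓ
  Extensional Φ = ∀ {σ τ} → (∀ j → σ j ≡ τ j) → Φ σ ≈ Φ τ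

  Extensional-lift : ∀ {m n} {Φ : (Fin (suc m) → Fin (suc n)) → Carrier} →
                     Extensional Φ → Extensional (Φ ∘ Fin.lift 1)
  Extensional-lift Φ-ext σ≗τ = Φ-ext λ { zero → ≡.refl ; (suc j) → ≡.cong suc (σ≗τ j) }

  detBelow-extensional : ∀ {m n} (M : Fin (suc m) → Fin n → Carrier) → Extensional (detBelow M)
  detBelow-extensional M σ≗τ = det-cong (λ i j → reflexive (≡.cong (M (suc i)) (σ≗τ j)))

  expand₂ : ∀ {n} (a b : Fin (suc (suc n)) → Carrier) → ((Fin n → Fin (suc (suc n))) → Carrier) → Carrier
  expand₂ a b Φ = expand₁ a (λ σ → expand₁ (b ∘ σ) (Φ ∘ (σ ∘_)))

  expandTail : ∀ {n} → (Fin (suc (suc n)) → Carrier) → ((Fin n → Fin (suc (suc n))) → Carrier) → Carrier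
  expandTail a Φ = expand₁ (a ∘ suc) (Φ ∘ (suc ∘_))

  det-expand₂ : ∀ {n} (M : Mat (suc (suc n))) → det M ≈ expand₂ (M zero) (M (suc zero)) (detBelow (M ∘ suc))
  det-expand₂ M = trans (det-expand M)
    (Σ-cong (λ k → *-congˡ {sign (toℕ k)} (*-congˡ {M zero k} (det-expand (minor k M)))))

  expand₂-2×2 : (a b : Fin 2 → Carrier) {Φ : (Fin 0 → Fin 2) → Carrier} → Extensional Φ →
                expand₂ a b Φ ≈ (a zero * b (suc zero) + - 1# * (a (suc zero) * b zero)) * Φ (λ ())
  expand₂-2×2 a b {Φ} Φ-ext = begin
    1# * (a₀ * (1# * (b₁ * Φ _) + 0#)) + (- 1# * (a₁ * (1# * (b₀ * Φ _) + 0#)) + 0#)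
      ≈⟨ +-cong (*-congˡ (*-congˡ (+-congʳ (*-congˡ (*-congˡ (Φ-ext λ ()))))))
                (+-congʳ (*-congˡ (*-congˡ (+-congʳ (*-congˡ (*-congˡ (Φ-ext λ ()))))))) ⟩
    1# * (a₀ * (1# * (b₁ * φ) + 0#)) + (- 1# * (a₁ * (1# * (b₀ * φ) + 0#)) + 0#)
      ≈⟨ solve 6 (λ a₀ a₁ b₀ b₁ m φ →
                    con 1 :* (a₀ :* (con 1 :* (b₁ :* φ) :+ con 0))
                      :+ (m :* (a₁ :* (con 1 :* (b₀ :* φ) :+ con 0)) :+ con 0)
                    := (a₀ :* b₁ :+ m :* (a₁ :* b₀)) :* φ)
                 refl a₀ a₁ b₀ b₁ (- 1#) φ ⟩
    (a₀ * b₁ + - 1# * (a₁ * b₀)) * φ ∎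
    where
    a₀ = a zero
    a₁ = a (suc zero)
    b₀ = b zero
    b₁ = b (suc zero)
    φ = Φ (λ ())

  -- Split by the rows that use column 0: row a, row b, or neither.
  expand₂-step : ∀ {n} (a b : Fin (suc (suc (suc n))) → Carrier) {Φ} → Extensional Φ →
    expand₂ a b Φ ≈ a zero * expandTail b Φ
                    + (- (b zero * expandTail a Φ) + expand₂ (a ∘ suc) (b ∘ suc) (Φ ∘ Fin.lift 1))
  expand₂-step {n} a b {Φ} Φ-ext = begin
    1# * (a zero * expandTail b Φ) + Σ (λ k → - sign (toℕ k) * (a (suc k) * inner k))
      ≈⟨ +-cong (*-identityˡ _)
                (Σ-cong (λ k → *-congˡ { - sign (toℕ k)} (*-congˡ {a (suc k)} (inner-split k)))) ⟩
    a zero * expandTail b Φ + Σ (λ k → - sign (toℕ k) * (a (suc k) * (1# * (b zero * Z k) + - U k)))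
      ≈⟨ +-congˡ (Σ-cong (λ k → regroup (sign (toℕ k)) (a (suc k)) (b zero) (Z k) (U k))) ⟩
    a zero * expandTail b Φ + Σ (λ k → - (b zero * y k) + t k)
      ≈⟨ +-congˡ (Σ-+ (λ k → - (b zero * y k)) t) ⟩
    a zero * expandTail b Φ + (Σ (λ k → - (b zero * y k)) + Σ t)
      ≈⟨ +-congˡ (+-congʳ (trans (Σ-neg (λ k → b zero * y k)) (-‿cong (Σ-*ˡ (b zero) y)))) ⟩
    a zero * expandTail b Φ
      + (- (b zero * expandTail a Φ) + expand₂ (a ∘ suc) (b ∘ suc) (Φ ∘ Fin.lift 1)) ∎
    where
    inner Z U y t : Fin (suc (suc n)) → Carrier
    inner k = expand₁ (b ∘ punchIn (suc k)) (Φ ∘ (punchIn (suc k) ∘_))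
    Z k = Φ (suc ∘ punchIn k)
    U k = expand₁ (b ∘ suc ∘ punchIn k) (Φ ∘ Fin.lift 1 ∘ (punchIn k ∘_))
    y k = sign (toℕ k) * (a (suc k) * Z k)
    t k = sign (toℕ k) * (a (suc k) * U k)

    inner-split : ∀ k → inner k ≈ 1# * (b zero * Z k) + - U k
    inner-split k = +-congˡ (trans (Σ-cong term)
      (Σ-neg (λ l → sign (toℕ l) * (b (suc (punchIn k l)) * Φ (Fin.lift 1 (punchIn k ∘ punchIn l))))))
      where
      term : ∀ l → - sign (toℕ l) * (b (suc (punchIn k l)) * Φ (punchIn (suc k) ∘ punchIn (suc l)))
                   ≈ - (sign (toℕ l) * (b (suc (punchIn k l)) * Φ (Fin.lift 1 (punchIn k ∘ punchIn l))))
      term l = trans (sym (-‿distribˡ-* (sign (toℕ l)) _))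
                     (-‿cong (*-congˡ (*-congˡ (Φ-ext λ { zero → ≡.refl ; (suc j) → ≡.refl }))))

    regroup : ∀ s a b z u → - s * (a * (1# * (b * z) + - u)) ≈ - (b * (s * (a * z))) + s * (a * u)
    regroup s a b z u = begin
      - s * (a * (1# * (b * z) + - u))             ≈⟨ -‿distribˡ-* s _ ⟨
      - (s * (a * (1# * (b * z) + - u)))
        ≈⟨ -‿cong (solve 5 (λ s a b z v → s :* (a :* (con 1 :* (b :* z) :+ v))
                                           := b :* (s :* (a :* z)) :+ s :* (a :* v))
                           refl s a b z (- u)) ⟩
      - (b * (s * (a * z)) + s * (a * - u))        ≈⟨ -‿cong (+-congˡ (*-congˡ (-‿distribʳ-* a u))) ⟨
      - (b * (s * (a * z)) + s * - (a * u))        ≈⟨ -‿cong (+-congˡ (-‿distribʳ-* s (a * u))) ⟨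
      - (b * (s * (a * z)) + - (s * (a * u)))      ≈⟨ -‿anti-homo-+ _ _ ⟩
      - - (s * (a * u)) + - (b * (s * (a * z)))    ≈⟨ +-comm _ _ ⟩
      - (b * (s * (a * z))) + - - (s * (a * u))    ≈⟨ +-congˡ (-‿involutive _) ⟩
      - (b * (s * (a * z))) + s * (a * u)          ∎

  [1-1]*x≈0 : ∀ x → (1# + - 1#) * x ≈ 0#
  [1-1]*x≈0 x = trans (*-congʳ (-‿inverseʳ 1#)) (zeroˡ x)

  expand₂-antisym : ∀ {n} (a b : Fin (suc (suc n)) → Carrier) {Φ} → Extensional Φ →
                    expand₂ a b Φ + expand₂ b a Φ ≈ 0#
  expand₂-antisym {zero} a b {Φ} Φ-ext = begin
    expand₂ a b Φ + expand₂ b a Φ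
      ≈⟨ +-cong (expand₂-2×2 a b Φ-ext) (expand₂-2×2 b a Φ-ext) ⟩
    (a₀ * b₁ + - 1# * (a₁ * b₀)) * φ + (b₀ * a₁ + - 1# * (b₁ * a₀)) * φ
      ≈⟨ solve 6 (λ a₀ a₁ b₀ b₁ m φ → (a₀ :* b₁ :+ m :* (a₁ :* b₀)) :* φ
                                        :+ (b₀ :* a₁ :+ m :* (b₁ :* a₀)) :* φ
                                      := (con 1 :+ m) :* ((a₀ :* b₁ :+ a₁ :* b₀) :* φ))
                 refl a₀ a₁ b₀ b₁ (- 1#) φ ⟩
    (1# + - 1#) * ((a₀ * b₁ + a₁ * b₀) * φ)
      ≈⟨ [1-1]*x≈0 _ ⟩
    0# ∎
    where
    a₀ = a zero
    a₁ = a (suc zero)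
    b₀ = b zero
    b₁ = b (suc zero)
    φ = Φ (λ ())
  expand₂-antisym {suc n} a b {Φ} Φ-ext = begin
    expand₂ a b Φ + expand₂ b a Φ
      ≈⟨ +-cong (expand₂-step a b Φ-ext) (expand₂-step b a Φ-ext) ⟩
    (x + (- y + t)) + (y + (- x + t′))
      ≈⟨ solve 6 (λ x x′ y y′ t t′ → (x :+ (y′ :+ t)) :+ (y :+ (x′ :+ t′))
                                      := (x :+ x′) :+ ((y :+ y′) :+ (t :+ t′)))
                 refl x (- x) y (- y) t t′ ⟩
    (x + - x) + ((y + - y) + (t + t′))
      ≈⟨ +-cong (-‿inverseʳ x) (+-cong (-‿inverseʳ y)
           (expand₂-antisym (a ∘ suc) (b ∘ suc) (Extensional-lift Φ-ext))) ⟩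
    0# + (0# + 0#)
      ≈⟨ trans (+-identityˡ _) (+-identityˡ 0#) ⟩
    0# ∎
    where
    x = a zero * expandTail b Φ
    y = b zero * expandTail a Φ
    t = expand₂ (a ∘ suc) (b ∘ suc) (Φ ∘ Fin.lift 1)
    t′ = expand₂ (b ∘ suc) (a ∘ suc) (Φ ∘ Fin.lift 1)

  expand₂-self : ∀ {n} (a : Fin (suc (suc n)) → Carrier) {Φ} → Extensional Φ → expand₂ a a Φ ≈ 0#
  expand₂-self {zero} a {Φ} Φ-ext = begin
    expand₂ a a Φ
      ≈⟨ expand₂-2×2 a a Φ-ext ⟩
    (a₀ * a₁ + - 1# * (a₁ * a₀)) * φ
      ≈⟨ solve 4 (λ a₀ a₁ m φ → (a₀ :* a₁ :+ m :* (a₁ :* a₀)) :* φ := (con 1 :+ m) :* (a₀ :* a₁ :* φ))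
                 refl a₀ a₁ (- 1#) φ ⟩
    (1# + - 1#) * (a₀ * a₁ * φ)
      ≈⟨ [1-1]*x≈0 _ ⟩
    0# ∎
    where
    a₀ = a zero
    a₁ = a (suc zero)
    φ = Φ (λ ())
  expand₂-self {suc n} a {Φ} Φ-ext = begin
    expand₂ a a Φ      ≈⟨ expand₂-step a a Φ-ext ⟩
    x + (- x + t)      ≈⟨ +-assoc x (- x) t ⟨
    (x + - x) + t      ≈⟨ +-cong (-‿inverseʳ x) (expand₂-self (a ∘ suc) (Extensional-lift Φ-ext)) ⟩
    0# + 0#            ≈⟨ +-identityˡ 0# ⟩
    0#                 ∎
    where
    x = a zero * expandTail a Φ
    t = expand₂ (a ∘ suc) (a ∘ suc) (Φ ∘ Fin.lift 1)

  swapFirstRows : ∀ {n} → Mat (suc (suc n)) → Mat (suc (suc n))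
  swapFirstRows M zero          = M (suc zero)
  swapFirstRows M (suc zero)    = M zero
  swapFirstRows M (suc (suc i)) = M (suc (suc i))

  det+det-swapFirstRows : ∀ {n} (M : Mat (suc (suc n))) → det M + det (swapFirstRows M) ≈ 0#
  det+det-swapFirstRows M = trans (+-cong (det-expand₂ M) (det-expand₂ (swapFirstRows M)))
    (expand₂-antisym (M zero) (M (suc zero)) (detBelow-extensional (M ∘ suc)))

  det-equal-first-rows : ∀ {n} (M : Mat (suc (suc n))) → (∀ j → M zero j ≈ M (suc zero) j) → det M ≈ 0#
  det-equal-first-rows M M₀≈M₁ = begin
    det M                                            ≈⟨ det-cong M′≈M ⟨
    det M′                                           ≈⟨ det-expand₂ M′ ⟩
    expand₂ (M zero) (M zero) (detBelow (M ∘ suc))   ≈⟨ expand₂-self (M zero) (detBelow-extensional (M ∘ suc)) ⟩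
    0#                                               ∎
    where
    M′ : Mat _
    M′ (suc zero) = M zero
    M′ i          = M i
    M′≈M : ∀ i j → M′ i j ≈ M i j
    M′≈M zero          j = refl
    M′≈M (suc zero)    j = M₀≈M₁ j
    M′≈M (suc (suc i)) j = refl

  -- Rows 0 and b ≥ 2 are handled by swapping rows 0 and 1, after which both equal rows lie
  -- below the first row and the minors of the first-row expansion are smaller instances.
  mutual
    det-equal-rows : ∀ {n} (M : Mat n) {a b : Fin n} → toℕ a < toℕ b → (∀ j → M a j ≈ M b j) → det M ≈ 0#
    det-equal-rows M {zero}  {zero}          ()
    det-equal-rows M {suc a} {zero}          ()
    det-equal-rows M {zero}  {suc zero}      _   Ma≈Mb = det-equal-first-rows M Ma≈Mb
    det-equal-rows M {zero}  {suc (suc b)}   _   Ma≈Mb = begin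
      det M                           ≈⟨ +-identityʳ (det M) ⟨
      det M + 0#
        ≈⟨ +-congˡ (det-equal-rows-below (swapFirstRows M) {zero} {suc b} (s≤s z≤n) Ma≈Mb) ⟨
      det M + det (swapFirstRows M)   ≈⟨ det+det-swapFirstRows M ⟩
      0#                              ∎
    det-equal-rows M {suc a} {suc b}         a<b Ma≈Mb = det-equal-rows-below M (ℕ.s<s⁻¹ a<b) Ma≈Mb

    det-equal-rows-below : ∀ {n} (M : Mat (suc n)) {a b : Fin n} → toℕ a < toℕ b →
                           (∀ j → M (suc a) j ≈ M (suc b) j) → det M ≈ 0#
    det-equal-rows-below M a<b Ma≈Mb = trans (det-expand M)
      (Σ-zero (λ k → x≈0⇒s*[a*x]≈0 (sign (toℕ k)) (M zero k)
                       (det-equal-rows (minor k M) a<b (Ma≈Mb ∘ punchIn k))))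

  -- Complete homogeneous symmetric polynomials

  sumBelow : ℕ → (ℕ → Carrier) → Carrier
  sumBelow n f = sumL (List.applyUpTo f n)

  sumBelow-cong : ∀ n {f g : ℕ → Carrier} → (∀ a → a < n → f a ≈ g a) → sumBelow n f ≈ sumBelow n g
  sumBelow-cong zero    f≈g = refl
  sumBelow-cong (suc n) f≈g = +-cong (f≈g 0 (s≤s z≤n)) (sumBelow-cong n (λ a a<n → f≈g (suc a) (s≤s a<n)))

  sumBelow-zero : ∀ n {f : ℕ → Carrier} → (∀ a → f a ≈ 0#) → sumBelow n f ≈ 0#
  sumBelow-zero zero    f≈0 = refl
  sumBelow-zero (suc n) f≈0 = trans (+-cong (f≈0 0) (sumBelow-zero n (f≈0 ∘ suc))) (+-identityʳ 0#)

  sumBelow-truncate : ∀ m n {f : ℕ → Carrier} → m < n → (∀ a → m < a → f a ≈ 0#) →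
                      sumBelow n f ≈ sumBelow (suc m) f
  sumBelow-truncate zero    (suc n) _         f≈0 = +-congˡ (sumBelow-zero n (λ a → f≈0 (suc a) (s≤s z≤n)))
  sumBelow-truncate (suc m) (suc n) (s≤s m<n) f≈0 =
    +-congˡ (sumBelow-truncate m n m<n (λ a m<a → f≈0 (suc a) (s≤s m<a)))

  sumBelow-*ˡ : ∀ n x (f : ℕ → Carrier) → sumBelow n (λ a → x * f a) ≈ x * sumBelow n f
  sumBelow-*ˡ zero    x f = sym (zeroʳ x)
  sumBelow-*ˡ (suc n) x f = trans (+-congˡ (sumBelow-*ˡ n x (f ∘ suc))) (sym (distribˡ x _ _))

  sumL-++ : ∀ xs ys → sumL (xs List.++ ys) ≈ sumL xs + sumL ys
  sumL-++ List.[]       ys = sym (+-identityˡ _)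
  sumL-++ (x List.∷ xs) ys = trans (+-congˡ (sumL-++ xs ys)) (sym (+-assoc x _ _))

  sumL-map-*ˡ : ∀ {a} {A : Set a} x (f : A → Carrier) xs →
                sumL (List.map (λ k → x * f k) xs) ≈ x * sumL (List.map f xs)
  sumL-map-*ˡ x f List.[]       = sym (zeroʳ x)
  sumL-map-*ˡ x f (k List.∷ ks) = trans (+-congˡ (sumL-map-*ˡ x f ks)) (sym (distribˡ x _ _))

  filter-map : ∀ {a b p} {A : Set a} {B : Set b} {P : Pred B p} (P? : Decidable P) (f : A → B) xs →
               List.filter P? (List.map f xs) ≡ List.map f (List.filter (P? ∘ f) xs)
  filter-map P? f List.[]       = ≡.refl
  filter-map P? f (x List.∷ xs) with does (P? (f x))
  ... | true  = ≡.cong (f x List.∷_) (filter-map P? f xs)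
  ... | false = filter-map P? f xs

  filteredSum : ∀ {a p} {A : Set a} {P : Pred A p} → Decidable P → (A → Carrier) → List A → Carrier
  filteredSum P? f xs = sumL (List.map f (List.filter P? xs))

  filteredSum-concatMap : ∀ {a b p} {A : Set a} {B : Set b} {P : Pred A p} (P? : Decidable P) f (g : B → List A) bs →
    filteredSum P? f (List.concatMap g bs) ≈ sumL (List.map (filteredSum P? f ∘ g) bs)
  filteredSum-concatMap P? f g List.[]       = refl
  filteredSum-concatMap P? f g (b List.∷ bs) = begin
    sumL (List.map f (List.filter P? (g b List.++ List.concatMap g bs)))
      ≡⟨ ≡.cong (sumL ∘ List.map f) (Listₚ.filter-++ P? (g b) (List.concatMap g bs)) ⟩
    sumL (List.map f (List.filter P? (g b) List.++ List.filter P? (List.concatMap g bs)))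
      ≡⟨ ≡.cong sumL (Listₚ.map-++ f (List.filter P? (g b)) _) ⟩
    sumL (List.map f (List.filter P? (g b)) List.++ List.map f (List.filter P? (List.concatMap g bs)))
      ≈⟨ sumL-++ (List.map f (List.filter P? (g b))) _ ⟩
    filteredSum P? f (g b) + filteredSum P? f (List.concatMap g bs)
      ≈⟨ +-congˡ (filteredSum-concatMap P? f g bs) ⟩
    filteredSum P? f (g b) + sumL (List.map (filteredSum P? f ∘ g) bs) ∎

  filteredSum-cons : ∀ {n p} {P : Pred (Vec ℕ (suc n)) p} (P? : Decidable P) x (xs : Vec Carrier n) a L →
    filteredSum P? (monomial (x ∷ xs)) (List.map (a ∷_) L) ≈ x ^ a * filteredSum (P? ∘ (a ∷_)) (monomial xs) L
  filteredSum-cons P? x xs a L = begin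
    sumL (List.map (monomial (x ∷ xs)) (List.filter P? (List.map (a ∷_) L)))
      ≡⟨ ≡.cong (sumL ∘ List.map (monomial (x ∷ xs))) (filter-map P? (a ∷_) L) ⟩
    sumL (List.map (monomial (x ∷ xs)) (List.map (a ∷_) (List.filter (P? ∘ (a ∷_)) L)))
      ≡⟨ ≡.cong sumL (Listₚ.map-∘ (List.filter (P? ∘ (a ∷_)) L)) ⟨
    sumL (List.map (λ k → x ^ a * monomial xs k) (List.filter (P? ∘ (a ∷_)) L))
      ≈⟨ sumL-map-*ˡ (x ^ a) (monomial xs) (List.filter (P? ∘ (a ∷_)) L) ⟩
    x ^ a * filteredSum (P? ∘ (a ∷_)) (monomial xs) L ∎

  sumIs : ∀ {n} (m : ℕ) → Decidable (λ (k : Vec ℕ n) → Vec.sum k ≡ m)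
  sumIs m k = Vec.sum k ℕ.≟ m

  -- Defs.h m sums over the box {0,…,m}^N. Splitting off the first exponent a lowers the degree to
  -- m - a but keeps the box, so the recursion needs the box bound B as a separate parameter.
  boxedH : ℕ → ℕ → ∀ {n} → Vec Carrier n → Carrier
  boxedH B m {n} xs = filteredSum (sumIs m) (monomial xs) (boxVecs B n)

  boxedH-cons : ∀ {n} B m x (xs : Vec Carrier n) → m ≤ B →
                boxedH B m (x ∷ xs) ≈ sumBelow (suc m) (λ a → x ^ a * boxedH B (m ∸ a) xs)
  boxedH-cons {n} B m x xs m≤B = begin
    boxedH B m (x ∷ xs)
      ≈⟨ filteredSum-concatMap (sumIs m) (monomial (x ∷ xs)) column (List.upTo (suc B)) ⟩
    sumL (List.map piece (List.upTo (suc B)))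
      ≡⟨ ≡.cong sumL (Listₚ.map-upTo piece (suc B)) ⟩
    sumBelow (suc B) piece
      ≈⟨ sumBelow-truncate m (suc B) (s≤s m≤B) piece-> ⟩
    sumBelow (suc m) piece
      ≈⟨ sumBelow-cong (suc m) (λ a a≤m → piece-≤ a (ℕₚ.≤-pred a≤m)) ⟩
    sumBelow (suc m) (λ a → x ^ a * boxedH B (m ∸ a) xs) ∎
    where
    column : ℕ → List (Vec ℕ (suc n))
    column a = List.map (a ∷_) (boxVecs B n)

    piece : ℕ → Carrier
    piece = filteredSum (sumIs m) (monomial (x ∷ xs)) ∘ column

    piece-≤ : ∀ a → a ≤ m → piece a ≈ x ^ a * boxedH B (m ∸ a) xs
    piece-≤ a a≤m = trans (filteredSum-cons (sumIs m) x xs a (boxVecs B n))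
      (*-congˡ (reflexive (≡.cong (sumL ∘ List.map (monomial xs))
        (Listₚ.filter-≐ (sumIs m ∘ (a ∷_)) (sumIs (m ∸ a))
                        ((λ {k} → a+s≡m⇒s≡m∸a {k}) , (λ {k} → s≡m∸a⇒a+s≡m {k})) (boxVecs B n)))))
      where
      a+s≡m⇒s≡m∸a : ∀ {k : Vec ℕ n} → a ℕ.+ Vec.sum k ≡ m → Vec.sum k ≡ m ∸ a
      a+s≡m⇒s≡m∸a {k} e = ≡.trans (≡.sym (ℕₚ.m+n∸m≡n a (Vec.sum k))) (≡.cong (_∸ a) e)
      s≡m∸a⇒a+s≡m : ∀ {k : Vec ℕ n} → Vec.sum k ≡ m ∸ a → a ℕ.+ Vec.sum k ≡ m
      s≡m∸a⇒a+s≡m e = ≡.trans (≡.cong (a ℕ.+_) e) (ℕₚ.m+[n∸m]≡n a≤m)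

    piece-> : ∀ a → m < a → piece a ≈ 0#
    piece-> a m<a = trans (filteredSum-cons (sumIs m) x xs a (boxVecs B n))
      (trans (*-congˡ (reflexive (≡.cong (sumL ∘ List.map (monomial xs))
               (Listₚ.filter-none (sumIs m ∘ (a ∷_)) (ListAll.universal a+s≢m (boxVecs B n))))))
             (zeroʳ _))
      where
      a+s≢m : ∀ (k : Vec ℕ n) → ¬ (a ℕ.+ Vec.sum k ≡ m)
      a+s≢m k e = ℕₚ.<-irrefl (≡.sym e) (ℕₚ.<-≤-trans m<a (ℕₚ.m≤m+n a (Vec.sum k)))

  mutual
    boxedH≈h : ∀ {n} B m (xs : Vec Carrier n) → m ≤ B → boxedH B m xs ≈ h m xs
    boxedH≈h B m []       _   = refl
    boxedH≈h B m (x ∷ xs) m≤B = begin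
      boxedH B m (x ∷ xs)
        ≈⟨ boxedH-cons B m x xs m≤B ⟩
      sumBelow (suc m) (λ a → x ^ a * boxedH B (m ∸ a) xs)
        ≈⟨ sumBelow-cong (suc m) (λ a _ →
             *-congˡ {x ^ a} (boxedH≈h B (m ∸ a) xs (ℕₚ.≤-trans (ℕₚ.m∸n≤m m a) m≤B))) ⟩
      sumBelow (suc m) (λ a → x ^ a * h (m ∸ a) xs)
        ≈⟨ h-cons m x xs ⟨
      h m (x ∷ xs) ∎

    h-cons : ∀ {n} m x (xs : Vec Carrier n) → h m (x ∷ xs) ≈ sumBelow (suc m) (λ a → x ^ a * h (m ∸ a) xs)
    h-cons m x xs = trans (boxedH-cons m m x xs ℕₚ.≤-refl)
      (sumBelow-cong (suc m) (λ a _ → *-congˡ {x ^ a} (boxedH≈h m (m ∸ a) xs (ℕₚ.m∸n≤m m a))))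

  h-zero : ∀ {n} (xs : Vec Carrier n) → h 0 xs ≈ 1#
  h-zero []       = +-identityʳ 1#
  h-zero (x ∷ xs) = trans (h-cons 0 x xs) (trans (+-identityʳ _) (trans (*-identityˡ _) (h-zero xs)))

  h-suc-cons : ∀ {n} m x (xs : Vec Carrier n) → h (suc m) (x ∷ xs) ≈ h (suc m) xs + x * h m (x ∷ xs)
  h-suc-cons m x xs = begin
    h (suc m) (x ∷ xs)
      ≈⟨ h-cons (suc m) x xs ⟩
    1# * h (suc m) xs + sumBelow (suc m) (λ a → (x * x ^ a) * h (m ∸ a) xs)
      ≈⟨ +-cong (*-identityˡ _) (sumBelow-cong (suc m) (λ a _ → *-assoc x (x ^ a) (h (m ∸ a) xs))) ⟩
    h (suc m) xs + sumBelow (suc m) (λ a → x * (x ^ a * h (m ∸ a) xs))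
      ≈⟨ +-congˡ (sumBelow-*ˡ (suc m) x (λ a → x ^ a * h (m ∸ a) xs)) ⟩
    h (suc m) xs + x * sumBelow (suc m) (λ a → x ^ a * h (m ∸ a) xs)
      ≈⟨ +-congˡ (*-congˡ (h-cons m x xs)) ⟨
    h (suc m) xs + x * h m (x ∷ xs) ∎

  -- Jets and the reduction of powers

  -- J y s stands for the Taylor coefficient p⁽ˢ⁾(y)/s! of a polynomial p.
  Jet : Set c
  Jet = Carrier → ℕ → Carrier

  infix  4 _≈ᴶ_
  infixl 6 _+ᴶ_
  infixl 7 _·ᴶ_

  _≈ᴶ_ : Jet → Jet → Set (c ⊔ ℓ)
  J ≈ᴶ K = ∀ y s → J y s ≈ K y s

  _+ᴶ_ : Jet → Jet → Jet
  (J +ᴶ K) y s = J y s + K y s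

  _·ᴶ_ : Carrier → Jet → Jet
  (β ·ᴶ J) y s = β * J y s

  powerJet : ℕ → Jet
  powerJet i y s = ι (i C s) * y ^ (i ∸ s)

  mulRoot : Carrier → Jet → Jet
  mulRoot a J y zero    = (y - a) * J y zero
  mulRoot a J y (suc s) = (y - a) * J y (suc s) + J y s

  mulRoots : ∀ {n} → Vec Carrier n → Jet → Jet
  mulRoots []       J = J
  mulRoots (x ∷ xs) J = mulRoot x (mulRoots xs J)

  mulRoot-cong : ∀ a {J K} → J ≈ᴶ K → mulRoot a J ≈ᴶ mulRoot a K
  mulRoot-cong a J≈K y zero    = *-congˡ (J≈K y zero)
  mulRoot-cong a J≈K y (suc s) = +-cong (*-congˡ (J≈K y (suc s))) (J≈K y s)

  mulRoot-linear : ∀ a J β K → mulRoot a (J +ᴶ β ·ᴶ K) ≈ᴶ mulRoot a J +ᴶ β ·ᴶ mulRoot a K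
  mulRoot-linear a J β K y zero =
    solve 4 (λ d j β k → d :* (j :+ β :* k) := d :* j :+ β :* (d :* k)) refl (y - a) (J y zero) β (K y zero)
  mulRoot-linear a J β K y (suc s) =
    solve 6 (λ d j β k j′ k′ → d :* (j :+ β :* k) :+ (j′ :+ β :* k′) := (d :* j :+ j′) :+ β :* (d :* k :+ k′))
            refl (y - a) (J y (suc s)) β (K y (suc s)) (J y s) (K y s)

  ι-+ : ∀ m n → ι (m ℕ.+ n) ≈ ι m + ι n
  ι-+ zero    n = sym (+-identityˡ (ι n))
  ι-+ (suc m) n = trans (+-congˡ (ι-+ m n)) (sym (+-assoc 1# (ι m) (ι n)))

  [y-p]*x+p*x≈y*x : ∀ y p x → (y - p) * x + p * x ≈ y * x
  [y-p]*x+p*x≈y*x y p x = begin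
    (y - p) * x + p * x   ≈⟨ distribʳ x (y - p) p ⟨
    (y - p + p) * x       ≈⟨ *-congʳ (+-assoc y (- p) p) ⟩
    (y + (- p + p)) * x   ≈⟨ *-congʳ (+-congˡ (-‿inverseˡ p)) ⟩
    (y + 0#) * x          ≈⟨ *-congʳ (+-identityʳ y) ⟩
    y * x                 ∎

  powerJet-suc : ∀ p i → powerJet (suc i) ≈ᴶ mulRoot p (powerJet i) +ᴶ p ·ᴶ powerJet i
  powerJet-suc p i y zero = begin
    ι 1 * (y * y ^ i)
      ≈⟨ solve 3 (λ c y q → c :* (y :* q) := y :* (c :* q)) refl (ι 1) y (y ^ i) ⟩
    y * (ι 1 * y ^ i)
      ≈⟨ [y-p]*x+p*x≈y*x y p (ι 1 * y ^ i) ⟨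
    (y - p) * (ι 1 * y ^ i) + p * (ι 1 * y ^ i) ∎
  powerJet-suc p i y (suc s) = begin
    ι (suc i C suc s) * Q
      ≈⟨ *-congʳ (reflexive (≡.cong ι (nCk+nC[k+1]≡[n+1]C[k+1] i s))) ⟨
    ι (i C s ℕ.+ i C suc s) * Q
      ≈⟨ *-congʳ (ι-+ (i C s) (i C suc s)) ⟩
    (B + A) * Q
      ≈⟨ solve 3 (λ b a q → (b :+ a) :* q := a :* q :+ b :* q) refl B A Q ⟩
    A * Q + B * Q
      ≈⟨ +-congʳ y*[A*P]≈A*Q ⟨
    y * (A * P) + B * Q
      ≈⟨ +-congʳ ([y-p]*x+p*x≈y*x y p (A * P)) ⟨
    ((y - p) * (A * P) + p * (A * P)) + B * Q
      ≈⟨ solve 3 (λ d a b → (d :+ a) :+ b := (d :+ b) :+ a) refl ((y - p) * (A * P)) (p * (A * P)) (B * Q) ⟩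
    ((y - p) * (A * P) + B * Q) + p * (A * P) ∎
    where
    A = ι (i C suc s)
    B = ι (i C s)
    P = y ^ (i ∸ suc s)
    Q = y ^ (i ∸ s)

    y*[A*P]≈A*Q : y * (A * P) ≈ A * Q
    y*[A*P]≈A*Q with s ℕ.<? i
    ... | yes s<i = begin
      y * (A * P)     ≈⟨ solve 3 (λ y a p → y :* (a :* p) := a :* (y :* p)) refl y A P ⟩
      A * (y * P)     ≡⟨ ≡.cong (λ e → A * y ^ e) (ℕₚ.+-∸-assoc 1 s<i) ⟨
      A * Q           ∎
    ... | no s≮i = begin
      y * (A * P)     ≈⟨ *-congˡ (*-congʳ (reflexive A≡0)) ⟩
      y * (0# * P)    ≈⟨ trans (*-congˡ (zeroˡ P)) (zeroʳ y) ⟩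
      0#              ≈⟨ trans (*-congʳ (reflexive A≡0)) (zeroˡ Q) ⟨
      A * Q           ∎
      where
      A≡0 : A ≡ 0#
      A≡0 = ≡.cong ι (k>n⇒nCk≡0 (s≤s (ℕₚ.≮⇒≥ s≮i)))

  VanishesBelow : Jet → Carrier → ℕ → Set ℓ
  VanishesBelow J z μ = ∀ s → s < μ → J z s ≈ 0#

  mulRoot-vanishes : ∀ a {J z μ} → VanishesBelow J z μ → VanishesBelow (mulRoot a J) z μ
  mulRoot-vanishes a J↓ zero    s<μ = trans (*-congˡ (J↓ zero s<μ)) (zeroʳ _)
  mulRoot-vanishes a J↓ (suc s) s<μ = trans
    (+-cong (trans (*-congˡ (J↓ (suc s) s<μ)) (zeroʳ _)) (J↓ s (ℕₚ.<-trans (ℕₚ.n<1+n s) s<μ)))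
    (+-identityʳ 0#)

  mulRoot-root : ∀ {J z μ} → VanishesBelow J z μ → VanishesBelow (mulRoot z J) z (suc μ)
  mulRoot-root {z = z} J↓ zero    _         = trans (*-congʳ (-‿inverseʳ z)) (zeroˡ _)
  mulRoot-root {z = z} J↓ (suc s) (s≤s s<μ) =
    trans (+-cong (trans (*-congʳ (-‿inverseʳ z)) (zeroˡ _)) (J↓ s s<μ)) (+-identityʳ 0#)

  mulRoots-vanishes : ∀ {n} (xs : Vec Carrier n) {J z μ} → VanishesBelow J z μ → VanishesBelow (mulRoots xs J) z μ
  mulRoots-vanishes []       J↓ = J↓
  mulRoots-vanishes (x ∷ xs) J↓ = mulRoot-vanishes x (mulRoots-vanishes xs J↓)

  mulRoots-replicate : ∀ c z J → VanishesBelow (mulRoots (Vec.replicate c z) J) z c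
  mulRoots-replicate zero    z J s ()
  mulRoots-replicate (suc c) z J = mulRoot-root (mulRoots-replicate c z J)

  mulRoots-++ : ∀ {m n} (xs : Vec Carrier m) (ys : Vec Carrier n) J →
                mulRoots (xs Vec.++ ys) J ≡ mulRoots xs (mulRoots ys J)
  mulRoots-++ []       ys J = ≡.refl
  mulRoots-++ (x ∷ xs) ys J = ≡.cong (mulRoot x) (mulRoots-++ xs ys J)

  record Linear (L : Jet → Carrier) : Set (c ⊔ ℓ) where
    field
      cong   : ∀ {J K} → J ≈ᴶ K → L J ≈ L K
      linear : ∀ J β K → L (J +ᴶ β ·ᴶ K) ≈ L J + β * L K

  Linear-mulRoot : ∀ {L} → Linear L → ∀ a → Linear (L ∘ mulRoot a)
  Linear-mulRoot L-lin a = record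
    { cong   = λ J≈K → Linear.cong L-lin (mulRoot-cong a J≈K)
    ; linear = λ J β K → trans (Linear.cong L-lin (mulRoot-linear a J β K))
                               (Linear.linear L-lin (mulRoot a J) β (mulRoot a K))
    }

  power-step : ∀ {L} → Linear L → ∀ p i → L (powerJet (suc i)) ≈ L (mulRoot p (powerJet i)) + p * L (powerJet i)
  power-step L-lin p i = trans (Linear.cong L-lin (powerJet-suc p i)) (Linear.linear L-lin _ p _)

  power-reduction-cons : ∀ {L} → Linear L → ∀ {K n} p (ps : Vec Carrier n) →
    (∀ m → L (mulRoot p (powerJet (m ℕ.+ K))) ≈ h (suc m) ps * L (powerJet K)) →
    ∀ m → L (powerJet (m ℕ.+ K)) ≈ h m (p ∷ ps) * L (powerJet K)
  power-reduction-cons {L} L-lin {K} p ps hyp zero = begin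
    L (powerJet K)                  ≈⟨ *-identityˡ _ ⟨
    1# * L (powerJet K)             ≈⟨ *-congʳ (h-zero (p ∷ ps)) ⟨
    h 0 (p ∷ ps) * L (powerJet K)   ∎
  power-reduction-cons {L} L-lin {K} p ps hyp (suc m) = begin
    L (powerJet (suc (m ℕ.+ K)))
      ≈⟨ power-step L-lin p (m ℕ.+ K) ⟩
    L (mulRoot p (powerJet (m ℕ.+ K))) + p * L (powerJet (m ℕ.+ K))
      ≈⟨ +-cong (hyp m) (*-congˡ (power-reduction-cons L-lin p ps hyp m)) ⟩
    h (suc m) ps * D + p * (h m (p ∷ ps) * D)
      ≈⟨ solve 4 (λ u p v d → u :* d :+ p :* (v :* d) := (u :+ p :* v) :* d)
                 refl (h (suc m) ps) p (h m (p ∷ ps)) D ⟩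
    (h (suc m) ps + p * h m (p ∷ ps)) * D
      ≈⟨ *-congʳ (h-suc-cons m p ps) ⟨
    h (suc m) (p ∷ ps) * D ∎
    where
    D = L (powerJet K)

  power-reduction : ∀ K (ps : Vec Carrier (suc K)) {L} → Linear L →
    (∀ J → L (mulRoots ps J) ≈ 0#) → (∀ i → i < K → L (powerJet i) ≈ 0#) →
    ∀ m → L (powerJet (m ℕ.+ K)) ≈ h m ps * L (powerJet K)
  power-reduction zero    (p ∷ [])     L-lin kills _   =
    power-reduction-cons L-lin p [] (λ m → trans (kills _) (sym (zeroˡ _)))
  power-reduction (suc K) (p ∷ ps) {L} L-lin kills low = power-reduction-cons L-lin p ps reduce
    where
    L′ : Jet → Carrier
    L′ = L ∘ mulRoot p

    shift : ∀ i → L (powerJet i) ≈ 0# → L′ (powerJet i) ≈ L (powerJet (suc i))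
    shift i Lxⁱ≈0 = begin
      L′ (powerJet i)                       ≈⟨ +-identityʳ _ ⟨
      L′ (powerJet i) + 0#                  ≈⟨ +-congˡ (trans (*-congˡ Lxⁱ≈0) (zeroʳ p)) ⟨
      L′ (powerJet i) + p * L (powerJet i)  ≈⟨ power-step L-lin p i ⟨
      L (powerJet (suc i))                  ∎

    low′ : ∀ i → i < K → L′ (powerJet i) ≈ 0#
    low′ i i<K = trans (shift i (low i (ℕₚ.<-trans i<K (ℕₚ.n<1+n K)))) (low (suc i) (s≤s i<K))

    reduce : ∀ m → L′ (powerJet (m ℕ.+ suc K)) ≈ h (suc m) ps * L (powerJet (suc K))
    reduce m = begin
      L′ (powerJet (m ℕ.+ suc K))          ≡⟨ ≡.cong (L′ ∘ powerJet) (ℕₚ.+-suc m K) ⟩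
      L′ (powerJet (suc m ℕ.+ K))          ≈⟨ power-reduction K ps (Linear-mulRoot L-lin p) kills low′ (suc m) ⟩
      h (suc m) ps * L′ (powerJet K)       ≈⟨ *-congˡ (shift K (low K (ℕₚ.n<1+n K))) ⟩
      h (suc m) ps * L (powerJet (suc K))  ∎

  -- The confluent Vandermonde matrix

  module LastRowFunctional {K : ℕ} (node : Fin (suc K) → Carrier) (order : Fin (suc K) → ℕ) where

    at : Jet → Fin (suc K) → Carrier
    at J k = J (node k) (order k)

    powerRows : Mat (suc K)
    powerRows j = at (powerJet (toℕ j))

    lastRowDet : Jet → Carrier
    lastRowDet J = det (withLastRow powerRows (at J))

    lastRowDet-linear : Linear lastRowDet
    lastRowDet-linear = record
      { cong   = λ J≈K → det-cong (withLastRow-cong powerRows (λ k → J≈K (node k) (order k)))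
      ; linear = λ J β K → det-withLastRow-linear powerRows (at J) (at K) β
      }

    lastRowDet-zero : ∀ {J} → (∀ k → at J k ≈ 0#) → lastRowDet J ≈ 0#
    lastRowDet-zero = det-withLastRow-zero powerRows

    lastRowDet-low : ∀ i → i < K → lastRowDet (powerJet i) ≈ 0#
    lastRowDet-low i i<K = det-equal-rows (withLastRow powerRows (at (powerJet i))) a<b rowᵢ≈rowₖ
      where
      a b : Fin (suc K)
      a = Fin.fromℕ< (ℕₚ.<-trans i<K (ℕₚ.n<1+n K))
      b = Fin.fromℕ K
      a≡i : toℕ a ≡ i
      a≡i = Finₚ.toℕ-fromℕ< _
      b≡K : toℕ b ≡ K
      b≡K = Finₚ.toℕ-fromℕ K
      a<b : toℕ a < toℕ b
      a<b = ≡.subst₂ _<_ (≡.sym a≡i) (≡.sym b≡K) i<K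
      rowᵢ≈rowₖ : ∀ j → withLastRow powerRows (at (powerJet i)) a j ≈ withLastRow powerRows (at (powerJet i)) b j
      rowᵢ≈rowₖ j = begin
        withLastRow powerRows (at (powerJet i)) a j
          ≡⟨ withLastRow-above powerRows (at (powerJet i)) (≡.subst (λ t → suc t ≤ K) (≡.sym a≡i) i<K) j ⟩
        at (powerJet (toℕ a)) j
          ≡⟨ ≡.cong (λ t → at (powerJet t) j) a≡i ⟩
        at (powerJet i) j
          ≡⟨ withLastRow-last powerRows (at (powerJet i)) b≡K j ⟨
        withLastRow powerRows (at (powerJet i)) b j ∎

  node : ∀ {n} (κ : Vec ℕ n) → Vec Carrier n → Fin (Vec.sum κ) → Carrier
  node κ y k = lookup y (proj₁ (locate κ k))

  order : ∀ {n} (κ : Vec ℕ n) → Fin (Vec.sum κ) → ℕ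
  order κ k = proj₂ (locate κ k) ∸ 1

  locate-positive : ∀ {n} (κ : Vec ℕ n) k → ∃ λ s → proj₂ (locate κ k) ≡ suc s
  locate-positive (c ∷ κ) k with splitAt c k
  ... | inj₁ i = toℕ i , ≡.refl
  ... | inj₂ i with locate κ i | locate-positive κ i
  ...   | _ , _ | s , r≡1+s = s , r≡1+s

  rep-vanishes : ∀ {n} (κ : Vec ℕ n) y J k → VanishesBelow (mulRoots (rep κ y) J) (node κ y k) (suc (order κ k))
  rep-vanishes (c ∷ κ) (y₀ ∷ ys) J k rewrite mulRoots-++ (Vec.replicate c y₀) (rep κ ys) J with splitAt c k
  ... | inj₁ i = λ s s≤i → mulRoots-replicate c y₀ _ s (ℕₚ.<-≤-trans s≤i (Finₚ.toℕ<n i))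
  ... | inj₂ i with locate κ i | rep-vanishes κ ys J i
  ...   | _ , _ | vanishes = mulRoots-vanishes (Vec.replicate c y₀) vanishes

  binomial-guard : ∀ t s x → (if suc s ≤ᵇ suc t then ι (t C s) * x else 0#) ≈ ι (t C s) * x
  binomial-guard t s x with suc s ≤ᵇ suc t in guard
  ... | true  = refl
  ... | false = sym (trans (*-congʳ (reflexive (≡.cong ι (k>n⇒nCk≡0 t<s)))) (zeroˡ x))
    where
    t<s : t < s
    t<s = ℕₚ.≰⇒> (λ s≤t → ≡.subst T guard (ℕₚ.≤⇒≤ᵇ (s≤s s≤t)))

  G-exponent : ∀ m {N} s → 1 ≤ N → m ℕ.+ N ∸ suc s ≡ N ∸ 1 ℕ.+ m ∸ s
  G-exponent m {suc N} s _ = ≡.trans (≡.cong (_∸ suc s) (ℕₚ.+-suc m N)) (≡.cong (_∸ s) (ℕₚ.+-comm m N))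

  G≈withLastRow : ∀ m {n} (κ : Vec ℕ n) y j k →
    G m κ y j k ≈ withLastRow (λ j k → powerJet (toℕ j) (node κ y k) (order κ k))
                              (λ k → powerJet (Vec.sum κ ∸ 1 ℕ.+ m) (node κ y k) (order κ k)) j k
  G≈withLastRow m κ y j k with locate κ k | locate-positive κ k
  ... | q , .(suc s) | s , ≡.refl with suc (toℕ j) ≤ᵇ Vec.sum κ ∸ 1
  ...   | true  = binomial-guard (toℕ j) s (lookup y q ^ (toℕ j ∸ s))
  ...   | false = *-congˡ (reflexive (≡.cong (lookup y q ^_)
                    (G-exponent m s (ℕₚ.≤-trans (s≤s z≤n) (Finₚ.toℕ<n k)))))


corollary6p4 : ∀ {c ℓ} (F : Field c ℓ) → FieldOps.CharZero F →
    (n : ℕ) → 1 ≤ n → (κ : Vec ℕ n) → All (1 ≤_) κ → (m : ℕ) →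
    (y : Vec (Field.Carrier F) n) →
    ¬ Field._≈_ F (FieldOps.det F (FieldOps.V F κ y)) (Field.0# F) →
    Field._≈_ F (Field._*_ F (FieldOps.h F m (FieldOps.rep F κ y)) (FieldOps.det F (FieldOps.V F κ y)))
    (FieldOps.det F (FieldOps.G F m κ y))
corollary6p4 F _ zero    () _ _ _ _ _
corollary6p4 F _ (suc _) _  κ@(_ ∷ κ′) (s≤s {n = c} z≤n ∷ _) m y _ = begin
  h m (rep κ y) * det (V κ y)
    ≈⟨ *-congˡ (det-cong (G≈withLastRow 0 κ y)) ⟩
  h m (rep κ y) * lastRowDet (powerJet (K ℕ.+ 0))
    ≡⟨ ≡.cong (λ i → h m (rep κ y) * lastRowDet (powerJet i)) (ℕₚ.+-identityʳ K) ⟩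
  h m (rep κ y) * lastRowDet (powerJet K)
    ≈⟨ power-reduction K (rep κ y) lastRowDet-linear rep-kills lastRowDet-low m ⟨
  lastRowDet (powerJet (m ℕ.+ K))
    ≡⟨ ≡.cong (lastRowDet ∘ powerJet) (ℕₚ.+-comm m K) ⟩
  lastRowDet (powerJet (K ℕ.+ m))
    ≈⟨ det-cong (G≈withLastRow m κ y) ⟨
  det (G m κ y) ∎
  where
  open Field F using (_≈_; _*_; 0#; setoid; *-congˡ)
  open FieldOps F using (h; det; rep; G; V)
  open ConfluentVandermonde F
  open LastRowFunctional (node κ y) (order κ)
  open import Relation.Binary.Reasoning.Setoid setoid

  K : ℕ
  K = c ℕ.+ Vec.sum κ′

  rep-kills : ∀ J → lastRowDet (mulRoots (rep κ y) J) ≈ 0#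
  rep-kills J = lastRowDet-zero {mulRoots (rep κ y) J}
                  (λ k → rep-vanishes κ y J k (order κ k) (ℕₚ.n<1+n (order κ k)))
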